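{- Let $G$ and $H$ be finite simple graphs whose vertex sets are subsets of a common set, and let $g:V(G)\cup V(H)\to\mathbb{R}$ be locally injective on $G$ and on $H$. For $v\in V(G)$ let $S_g(v)$ be the subgraph of $G$ induced by $\{u\in S_G(v): g(u)<g(v)\}$ and $B_g(v)$ the subgraph of $G$ induced by $\{u\in S_G(v): g(u)<g(v)\}\cup\{v\}$; for $w\in V(H)$ define $S_g(w)$, $B_g(w)$ analogously inside $H$. Then $$ f_{G,H}(t,s)=\sum_{v\in V(G)}\sum_{w\in V(H)}\Big( f_{B_g(v),B_g(w)}(t,s)-f_{B_g(v),S_g(w)}(t,s)-f_{S_g(v),B_g(w)}(t,s)+f_{S_g(v),S_g(w)}(t,s)\Big). $$
   Context: A function is locally injective on a graph if adjacent vertices get different values. $S_G(v)$ is the unit sphere of $v$ in $G$, i.e. the set of neighbors of $v$. An $i$-dimensional simplex of a graph is a complete subgraph with $i+1$ vertices (identified with its vertex set). For finite simple graphs $A,B$, $f_{ij}(A,B)$ is the number of pairs $(x,y)$ with $x$ an $i$-dimensional simplex of $A$ and $y$ a $j$-dimensional simplex of $B$ such that $x\cap y\ne\emptyset$, and the $f$-intersection function is $f_{A,B}(t,s)=\sum_{i,j} f_{ij}(A,B)\,t^i s^j$ (zero if $A$ or $B$ is empty). -}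

module Defs where

open import Level using (Level)
open import Data.Bool using (Bool; true; false; _∧_; _∨_; if_then_else_; not)
open import Data.Nat using (ℕ; zero; suc; _≡ᵇ_)
open import Data.Fin using (Fin; _≟_)
open import Data.Vec using (Vec; []; _∷_; lookup)
open import Data.List using (List; []; _∷_; [_]; map; _++_; allFin)
open import Data.Bool.ListAction using (all; any)
open import Data.Nat.ListAction using (sum)
open import Data.Integer using (ℤ; +_; _-_; _+_)
import Data.Integer as ℤ
open import Relation.Nullary using (¬_)
open import Relation.Nullary.Decidable using (⌊_⌋)
open import Relation.Binary.PropositionalEquality using (_≡_)
open import Relation.Binary.Bundles using (StrictTotalOrder)

record Graph (n : ℕ) : Set where
  field
    V : Fin n → Bool
    E : Fin n → Fin n → Bool
open Graph public

record IsSimpleGraph {n : ℕ} (G : Graph n) : Set where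
  field
    E-sym   : ∀ u v → E G u v ≡ E G v u
    E-irr   : ∀ u → E G u u ≡ false
    E-vert  : ∀ u v → E G u v ≡ true → V G u ≡ true

allSubsets : (n : ℕ) → List (Vec Bool n)
allSubsets zero = [ [] ]
allSubsets (suc n) = map (true ∷_) (allSubsets n) ++ map (false ∷_) (allSubsets n)

forallFin : {n : ℕ} → (Fin n → Bool) → Bool
forallFin {n} p = all p (allFin n)

existsFin : {n : ℕ} → (Fin n → Bool) → Bool
existsFin {n} p = any p (allFin n)

card : {n : ℕ} → Vec Bool n → ℕ
card x = sum (map (λ u → if lookup x u then 1 else 0) (allFin _))

_⇒ᵇ_ : Bool → Bool → Bool
a ⇒ᵇ b = not a ∨ b

isSimplex : {n : ℕ} → Graph n → ℕ → Vec Bool n → Bool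
isSimplex A i x =
  (card x ≡ᵇ suc i)
  ∧ forallFin (λ u → lookup x u ⇒ᵇ V A u)
  ∧ forallFin (λ u → forallFin (λ v →
       (lookup x u ∧ lookup x v ∧ not ⌊ u ≟ v ⌋) ⇒ᵇ E A u v))

meets : {n : ℕ} → Vec Bool n → Vec Bool n → Bool
meets x y = existsFin (λ u → lookup x u ∧ lookup y u)

-- f_{ij}(A,B): number of pairs (x,y), x an i-simplex of A, y a j-simplex of B, x ∩ y ≠ ∅.
-- The f-intersection polynomial f_{A,B}(t,s) = Σ f_{ij}(A,B) t^i s^j is determined by these.
fij : {n : ℕ} → Graph n → Graph n → ℕ → ℕ → ℕ
fij {n} A B i j =
  sum (map (λ x → sum (map (λ y →
        if isSimplex A i x ∧ isSimplex B j y ∧ meets x y then 1 else 0)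
      (allSubsets n))) (allSubsets n))

induced : {n : ℕ} → Graph n → (Fin n → Bool) → Graph n
induced A P = record
  { V = λ u → V A u ∧ P u
  ; E = λ u v → E A u v ∧ P u ∧ P v }

module _ {c ℓ₁ ℓ₂ : Level} (O : StrictTotalOrder c ℓ₁ ℓ₂) where
  open StrictTotalOrder O using (Carrier; _≈_; _<?_)

  LocallyInjective : {n : ℕ} → Graph n → (Fin n → Carrier) → Set ℓ₁
  LocallyInjective G g = ∀ u v → E G u v ≡ true → ¬ (g u ≈ g v)

  Sg : {n : ℕ} → Graph n → (Fin n → Carrier) → Fin n → Graph n
  Sg G g v = induced G (λ u → E G v u ∧ ⌊ g u <? g v ⌋)

  Bg : {n : ℕ} → Graph n → (Fin n → Carrier) → Fin n → Graph n
  Bg G g v = induced G (λ u → (E G v u ∧ ⌊ g u <? g v ⌋) ∨ ⌊ u ≟ v ⌋)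

sumV : {n : ℕ} → Graph n → (Fin n → ℤ) → ℤ
sumV {n} G h = Data.List.foldr _+_ (+ 0) (map (λ v → if V G v then h v else + 0) (allFin n))

-- For a fixed i-simplex x of a graph A, the difference between the indicators of x being a
-- simplex of B_g(v) and of S_g(v) is 1 exactly when v is the g-largest vertex of x, and 0
-- otherwise: B_g(v) is S_g(v) together with v, and v is never in S_g(v). Since g is injective
-- on the clique x, that vertex is unique, so summing these differences over v recovers the
-- indicator of x being a simplex of A. As f_ij(A, B) is a bilinear pairing of the simplex
-- indicators of A and B, the formula is the bilinear expansion of two such telescoping sums.

module Submission where

open import Defs
open import Level using (Level)
open import Data.Bool using (Bool; true; false; T; _∧_; _∨_; not; if_then_else_)
open import Data.Bool.Properties using (T-∧; T-∨; T-≡; ⇔→≡)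
open import Data.Empty using (⊥-elim)
open import Data.Fin using (Fin; zero; suc; _≟_)
open import Data.Integer using (ℤ; +_; _-_; _+_; _*_)
open import Data.Integer.Properties
  using (+-identityˡ; +-identityʳ; +-inverseʳ; *-identityˡ; *-zeroˡ; *-zeroʳ; *-distribˡ-+; *-comm; pos-+)
open import Data.Integer.Tactic.RingSolver using (solve-∀)
open import Data.List using (List; []; _∷_; map; foldr; filter; allFin)
open import Data.List.Properties using (map-cong; map-tabulate)
open import Data.List.Membership.Propositional.Properties using (∈-allFin; ∈-filter⁺)
open import Data.List.Relation.Unary.Any as Any using (Any; here; there)
import Data.List.Relation.Unary.All as All
open import Data.List.Relation.Unary.All.Properties using (all⁺; all⁻; all-filter)
import Data.List.Extrema as Extrema
open import Data.Nat using (ℕ; suc)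
open import Data.Nat.ListAction using (sum)
open import Data.Nat.Properties using (≡ᵇ⇒≡; ≡⇒≡ᵇ)
open import Data.Product using (∃; _×_; _,_; proj₁; proj₂)
open import Data.Product.Function.NonDependent.Propositional using (_×-⇔_)
open import Data.Sum using (_⊎_; inj₁; inj₂)
open import Data.Vec using (Vec; lookup)
open import Function using (_∘_; id; _⇔_; mk⇔; Equivalence)
open import Function.Properties.Equivalence using () renaming (trans to ⇔-trans; sym to ⇔-sym)
open import Relation.Nullary using (¬_; yes; no; does)
open import Relation.Nullary.Decidable
  using (⌊_⌋; T?; toWitness; fromWitness; toWitnessFalse; fromWitnessFalse)
open import Relation.Binary.PropositionalEquality
  using (_≡_; _≢_; refl; sym; trans; cong; cong₂; subst; module ≡-Reasoning)
open import Relation.Binary.Bundles using (StrictTotalOrder; DecTotalOrder)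
import Relation.Binary.Properties.StrictTotalOrder as StrictTotalOrderProperties

open Equivalence using (to; from)

private
  variable
    a b c : Level
    X : Set a
    Y : Set b
    Z : Set c
    n : ℕ

-- Integer sums over lists

∑ : List X → (X → ℤ) → ℤ
∑ L h = foldr _+_ (+ 0) (map h L)

infix 5 ∑
syntax ∑ L (λ x → e) = ∑[ x ∈ L ] e

∑-cong : ∀ (L : List X) {f g : X → ℤ} → (∀ x → f x ≡ g x) → ∑ L f ≡ ∑ L g
∑-cong L f≗g = cong (foldr _+_ (+ 0)) (map-cong f≗g L)

∑-zero : ∀ (L : List X) → ∑[ x ∈ L ] + 0 ≡ + 0
∑-zero [] = refl
∑-zero (x ∷ L) = trans (+-identityˡ (∑[ y ∈ L ] + 0)) (∑-zero L)

∑-+ : ∀ (L : List X) (f g : X → ℤ) → ∑[ x ∈ L ] (f x + g x) ≡ ∑ L f + ∑ L g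
∑-+ [] f g = refl
∑-+ (x ∷ L) f g = trans (cong (_+_ (f x + g x)) (∑-+ L f g)) (interchange (f x) (g x) (∑ L f) (∑ L g))
  where
  interchange : ∀ p q r s → p + q + (r + s) ≡ p + r + (q + s)
  interchange = solve-∀

∑-− : ∀ (L : List X) (f g : X → ℤ) → ∑[ x ∈ L ] (f x - g x) ≡ ∑ L f - ∑ L g
∑-− [] f g = refl
∑-− (x ∷ L) f g = trans (cong (_+_ (f x - g x)) (∑-− L f g)) (interchange (f x) (g x) (∑ L f) (∑ L g))
  where
  interchange : ∀ p q r s → p - q + (r - s) ≡ p + r - (q + s)
  interchange = solve-∀

∑-*ˡ : ∀ (L : List X) c (f : X → ℤ) → ∑[ x ∈ L ] c * f x ≡ c * ∑ L f
∑-*ˡ [] c f = sym (*-zeroʳ c)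
∑-*ˡ (x ∷ L) c f = trans (cong (_+_ (c * f x)) (∑-*ˡ L c f)) (sym (*-distribˡ-+ c (f x) (∑ L f)))

∑-*ʳ : ∀ (L : List X) c (f : X → ℤ) → ∑[ x ∈ L ] f x * c ≡ ∑ L f * c
∑-*ʳ L c f = trans (∑-cong L (λ x → *-comm (f x) c)) (trans (∑-*ˡ L c f) (*-comm c (∑ L f)))

∑-comm : ∀ (L : List X) (M : List Y) (f : X → Y → ℤ) →
  ∑[ x ∈ L ] ∑[ y ∈ M ] f x y ≡ ∑[ y ∈ M ] ∑[ x ∈ L ] f x y
∑-comm [] M f = sym (∑-zero M)
∑-comm (x ∷ L) M f = trans (cong (_+_ (∑ M (f x))) (∑-comm L M f))
  (sym (∑-+ M (f x) (λ y → ∑[ x′ ∈ L ] f x′ y)))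

∑-comm₃ : ∀ (K : List X) (L : List Y) (M : List Z) (f : X → Y → Z → ℤ) →
  ∑[ v ∈ K ] ∑[ x ∈ L ] ∑[ y ∈ M ] f v x y ≡ ∑[ x ∈ L ] ∑[ y ∈ M ] ∑[ v ∈ K ] f v x y
∑-comm₃ K L M f = trans (∑-comm K L (λ v x → ∑[ y ∈ M ] f v x y))
  (∑-cong L (λ x → ∑-comm K M (λ v y → f v x y)))

∑-filter : ∀ (p : X → Bool) L (h : X → ℤ) →
  ∑[ x ∈ filter (T? ∘ p) L ] h x ≡ ∑[ x ∈ L ] (if p x then h x else + 0)
∑-filter p [] h = refl
∑-filter p (x ∷ L) h with p x
... | true = cong (_+_ (h x)) (∑-filter p L h)
... | false = trans (∑-filter p L h) (sym (+-identityˡ _))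

+-sum : ∀ (L : List X) (f : X → ℕ) → + sum (map f L) ≡ ∑[ x ∈ L ] + f x
+-sum [] f = refl
+-sum (x ∷ L) f = trans (pos-+ (f x) _) (cong (_+_ (+ f x)) (+-sum L f))

∑-allFin-suc : ∀ (h : Fin (suc n) → ℤ) →
  ∑[ v ∈ allFin (suc n) ] h v ≡ h zero + (∑[ v ∈ allFin n ] h (suc v))
∑-allFin-suc h = cong (λ hs → h zero + foldr _+_ (+ 0) hs)
  (trans (map-tabulate suc h) (sym (map-tabulate id (h ∘ suc))))

χ : Bool → ℤ
χ b = + (if b then 1 else 0)

χ-∧ : ∀ p q → χ (p ∧ q) ≡ χ p * χ q
χ-∧ true true = refl
χ-∧ true false = refl
χ-∧ false true = refl
χ-∧ false false = refl

χ-*-absorb : ∀ p {z} → (T p → z ≡ + 1) → χ p * z ≡ χ p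
χ-*-absorb true z≡1 = trans (*-identityˡ _) (z≡1 _)
χ-*-absorb false {z} _ = *-zeroˡ z

∑-χ-≟ : (v : Fin n) → ∑[ w ∈ allFin n ] χ (does (w ≟ v)) ≡ + 1
∑-χ-≟ {suc n} zero =
  trans (∑-allFin-suc {n} (λ w → χ (does (w ≟ zero)))) (cong (_+_ (+ 1)) (∑-zero (allFin n)))
∑-χ-≟ {suc n} (suc v) = begin
  ∑[ w ∈ allFin (suc n) ] χ (does (w ≟ suc v))  ≡⟨ ∑-allFin-suc {n} (λ w → χ (does (w ≟ suc v))) ⟩
  + 0 + (∑[ w ∈ allFin n ] χ (does (w ≟ v)))     ≡⟨ +-identityˡ _ ⟩
  ∑[ w ∈ allFin n ] χ (does (w ≟ v))             ≡⟨ ∑-χ-≟ v ⟩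
  + 1                                             ∎
  where open ≡-Reasoning

T-injective : {p q : Bool} → T p ⇔ T q → p ≡ q
T-injective p⇔q = ⇔→≡ (⇔-trans (⇔-sym T-≡) (⇔-trans p⇔q T-≡))

∑-χ-unique : ∀ (p : Fin n → Bool) {v} → T (p v) → (∀ w → T (p w) → w ≡ v) →
  ∑[ w ∈ allFin n ] χ (p w) ≡ + 1
∑-χ-unique p {v} pv unique = trans (∑-cong (allFin _) (cong χ ∘ p≡[≟v])) (∑-χ-≟ v)
  where
  p≡[≟v] : ∀ w → p w ≡ does (w ≟ v)
  p≡[≟v] w with w ≟ v
  ... | yes refl = to T-≡ pv
  ... | no w≢v = T-injective (mk⇔ (w≢v ∘ unique w) λ ())

-- Simplices of induced subgraphs

T-⇒ᵇ : ∀ p {q} → T (p ⇒ᵇ q) ⇔ (T p → T q)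
T-⇒ᵇ false = mk⇔ (λ _ ()) _
T-⇒ᵇ true = mk⇔ (λ q _ → q) (λ f → f _)

T-forallFin : ∀ (p : Fin n → Bool) → T (forallFin p) ⇔ (∀ u → T (p u))
T-forallFin {n} p = mk⇔
  (λ t u → All.lookup (all⁺ p (allFin n) t) (∈-allFin u))
  (λ f → all⁻ p {xs = allFin n} (All.tabulate (λ {u} _ → f u)))

_⊆ᵇ_ : Vec Bool n → (Fin n → Bool) → Bool
x ⊆ᵇ P = forallFin (λ u → lookup x u ⇒ᵇ P u)

T-⊆ᵇ : ∀ (x : Vec Bool n) P → T (x ⊆ᵇ P) ⇔ (∀ u → T (lookup x u) → T (P u))
T-⊆ᵇ x P = mk⇔
  (λ t u → to (T-⇒ᵇ (lookup x u)) (to (T-forallFin _) t u))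
  (λ f → from (T-forallFin _) (λ u → from (T-⇒ᵇ (lookup x u)) (f u)))

card-nonempty : ∀ {x : Vec Bool n} {i} → card x ≡ suc i → ∃ λ u → T (lookup x u)
card-nonempty {x = x} = Any.satisfied ∘ go (allFin _)
  where
  go : ∀ {i} (L : List _) → sum (map (λ u → if lookup x u then 1 else 0) L) ≡ suc i → Any (T ∘ lookup x) L
  go [] ()
  go (u ∷ L) total with lookup x u in xu
  ... | true = here (from T-≡ xu)
  ... | false = there (go L total)

record IsSimplex (A : Graph n) (i : ℕ) (x : Vec Bool n) : Set where
  field
    card≡  : card x ≡ suc i
    ⊆V     : ∀ u → T (lookup x u) → T (V A u)
    clique : ∀ u w → T (lookup x u) → T (lookup x w) → u ≢ w → T (E A u w)
open IsSimplex

T-isSimplex : ∀ (A : Graph n) i x → T (isSimplex A i x) ⇔ IsSimplex A i x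
T-isSimplex A i x = mk⇔ reflect reify
  where
  edges : Fin _ → Fin _ → Bool
  edges u w = (lookup x u ∧ lookup x w ∧ not ⌊ u ≟ w ⌋) ⇒ᵇ E A u w
  reflect : T (isSimplex A i x) → IsSimplex A i x
  reflect t with to T-∧ t
  ... | c , t′ with to T-∧ t′
  ... | s , k = record
    { card≡ = ≡ᵇ⇒≡ (card x) (suc i) c
    ; ⊆V = to (T-⊆ᵇ x (V A)) s
    ; clique = λ u w xu xw u≢w → to (T-⇒ᵇ (lookup x u ∧ lookup x w ∧ not ⌊ u ≟ w ⌋))
        (to (T-forallFin (edges u)) (to (T-forallFin (λ u → forallFin (edges u))) k u) w)
        (from T-∧ (xu , from T-∧ (xw , fromWitnessFalse u≢w)))
    }
  reify : IsSimplex A i x → T (isSimplex A i x)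
  reify s = from T-∧ (≡⇒≡ᵇ (card x) (suc i) (card≡ s) , from T-∧ (from (T-⊆ᵇ x (V A)) (⊆V s) ,
    from (T-forallFin (λ u → forallFin (edges u))) λ u → from (T-forallFin (edges u)) λ w →
      from (T-⇒ᵇ (lookup x u ∧ lookup x w ∧ not ⌊ u ≟ w ⌋)) λ t →
        let xu , t′ = to T-∧ t ; xw , u≢w = to T-∧ t′ in clique s u w xu xw (toWitnessFalse u≢w)))

IsSimplex-induced : ∀ (A : Graph n) P i x →
  IsSimplex (induced A P) i x ⇔ (IsSimplex A i x × (∀ u → T (lookup x u) → T (P u)))
IsSimplex-induced A P i x = mk⇔
  (λ s → record
    { card≡ = card≡ s
    ; ⊆V = λ u xu → proj₁ (to T-∧ (⊆V s u xu))
    ; clique = λ u w xu xw u≢w → proj₁ (to T-∧ (clique s u w xu xw u≢w))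
    } , λ u xu → proj₂ (to T-∧ (⊆V s u xu)))
  (λ (s , x⊆P) → record
    { card≡ = card≡ s
    ; ⊆V = λ u xu → from T-∧ (⊆V s u xu , x⊆P u xu)
    ; clique = λ u w xu xw u≢w → from T-∧ (clique s u w xu xw u≢w , from T-∧ (x⊆P u xu , x⊆P w xw))
    })

isSimplex-induced : ∀ (A : Graph n) P i x → isSimplex (induced A P) i x ≡ isSimplex A i x ∧ x ⊆ᵇ P
isSimplex-induced A P i x = T-injective
  (⇔-trans (T-isSimplex (induced A P) i x) (⇔-trans (IsSimplex-induced A P i x)
    (⇔-sym (⇔-trans T-∧ (T-isSimplex A i x ×-⇔ T-⊆ᵇ x P)))))

insert : Fin n → (Fin n → Bool) → Fin n → Bool
insert v P u = P u ∨ ⌊ u ≟ v ⌋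

χ-⊆ᵇ-insert : ∀ (x : Vec Bool n) P v → ¬ T (P v) →
  χ (x ⊆ᵇ insert v P) - χ (x ⊆ᵇ P) ≡ χ (lookup x v ∧ x ⊆ᵇ insert v P)
χ-⊆ᵇ-insert x P v ¬Pv with lookup x v in xv
... | true = begin
    χ (x ⊆ᵇ insert v P) - χ (x ⊆ᵇ P)  ≡⟨ cong (λ s → χ (x ⊆ᵇ insert v P) - χ s) x⊈P ⟩
    χ (x ⊆ᵇ insert v P) + + 0         ≡⟨ +-identityʳ (χ (x ⊆ᵇ insert v P)) ⟩
    χ (x ⊆ᵇ insert v P)               ∎
  where
  open ≡-Reasoning
  x⊈P : x ⊆ᵇ P ≡ false
  x⊈P = T-injective (mk⇔ (λ t → ¬Pv (to (T-⊆ᵇ x P) t v (from T-≡ xv))) λ ())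
... | false = begin
    χ (x ⊆ᵇ insert v P) - χ (x ⊆ᵇ P)  ≡⟨ cong (λ s → χ s - χ (x ⊆ᵇ P)) x⊆P∪v≡x⊆P ⟩
    χ (x ⊆ᵇ P) - χ (x ⊆ᵇ P)          ≡⟨ +-inverseʳ (χ (x ⊆ᵇ P)) ⟩
    + 0                               ∎
  where
  open ≡-Reasoning
  drop-v : ∀ u → T (lookup x u) → T (insert v P u) → T (P u)
  drop-v u xu Pu∨u≡v with to T-∨ Pu∨u≡v
  ... | inj₁ Pu = Pu
  ... | inj₂ u≡v with refl ← toWitness u≡v = ⊥-elim (subst T xv xu)
  x⊆P∪v≡x⊆P : x ⊆ᵇ insert v P ≡ x ⊆ᵇ P
  x⊆P∪v≡x⊆P = T-injective (mk⇔
    (λ t → from (T-⊆ᵇ x P) (λ u xu → drop-v u xu (to (T-⊆ᵇ x (insert v P)) t u xu)))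
    (λ t → from (T-⊆ᵇ x (insert v P)) (λ u xu → from T-∨ (inj₁ (to (T-⊆ᵇ x P) t u xu)))))

vertices : Graph n → List (Fin n)
vertices A = filter (T? ∘ V A) (allFin _)

sumV-∑ : ∀ (A : Graph n) h → sumV A h ≡ ∑[ v ∈ vertices A ] h v
sumV-∑ A h = sym (∑-filter (V A) (allFin _) h)

-- The intersection pairing

module Pairing (L : List X) (k : X → X → ℤ) where

  ⟪_∣_⟫ : (X → ℤ) → (X → ℤ) → ℤ
  ⟪ α ∣ β ⟫ = ∑[ x ∈ L ] ∑[ y ∈ L ] α x * (β y * k x y)

  ⟪⟫-cong : ∀ {α α′ β β′ : X → ℤ} → (∀ x → α x ≡ α′ x) → (∀ y → β y ≡ β′ y) → ⟪ α ∣ β ⟫ ≡ ⟪ α′ ∣ β′ ⟫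
  ⟪⟫-cong α≗α′ β≗β′ = ∑-cong L λ x → ∑-cong L λ y → cong₂ (λ p q → p * (q * k x y)) (α≗α′ x) (β≗β′ y)

  ⟪⟫-−ˡ : ∀ (α α′ β : X → ℤ) → ⟪ (λ x → α x - α′ x) ∣ β ⟫ ≡ ⟪ α ∣ β ⟫ - ⟪ α′ ∣ β ⟫
  ⟪⟫-−ˡ α α′ β = trans (∑-cong L λ x → trans (∑-cong L λ y → distrib (α x) (α′ x) _) (∑-− L _ _)) (∑-− L _ _)
    where
    distrib : ∀ p q r → (p - q) * r ≡ p * r - q * r
    distrib = solve-∀

  ⟪⟫-−ʳ : ∀ (α β β′ : X → ℤ) → ⟪ α ∣ (λ y → β y - β′ y) ⟫ ≡ ⟪ α ∣ β ⟫ - ⟪ α ∣ β′ ⟫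
  ⟪⟫-−ʳ α β β′ = trans (∑-cong L λ x → trans (∑-cong L λ y → distrib (α x) (β y) (β′ y) _) (∑-− L _ _)) (∑-− L _ _)
    where
    distrib : ∀ p q r s → p * ((q - r) * s) ≡ p * (q * s) - p * (r * s)
    distrib = solve-∀

  ⟪⟫-expand : ∀ (α α′ β β′ : X → ℤ) → ⟪ (λ x → α x - α′ x) ∣ (λ y → β y - β′ y) ⟫ ≡
    ⟪ α ∣ β ⟫ - ⟪ α ∣ β′ ⟫ - ⟪ α′ ∣ β ⟫ + ⟪ α′ ∣ β′ ⟫
  ⟪⟫-expand α α′ β β′ = trans (⟪⟫-−ˡ α α′ (λ y → β y - β′ y))
    (trans (cong₂ _-_ (⟪⟫-−ʳ α β β′) (⟪⟫-−ʳ α′ β β′)) (regroup ⟪ α ∣ β ⟫ ⟪ α ∣ β′ ⟫ ⟪ α′ ∣ β ⟫ ⟪ α′ ∣ β′ ⟫))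
    where
    regroup : ∀ p q r s → p - q - (r - s) ≡ p - q - r + s
    regroup = solve-∀

  ⟪⟫-∑ˡ : ∀ (K : List Y) (α : Y → X → ℤ) (β : X → ℤ) → ∑[ v ∈ K ] ⟪ α v ∣ β ⟫ ≡ ⟪ (λ x → ∑[ v ∈ K ] α v x) ∣ β ⟫
  ⟪⟫-∑ˡ K α β = trans (∑-comm₃ K L L (λ v x y → α v x * (β y * k x y)))
    (∑-cong L λ x → ∑-cong L λ y → ∑-*ʳ K (β y * k x y) (λ v → α v x))

  ⟪⟫-∑ʳ : ∀ (K : List Y) (α : X → ℤ) (β : Y → X → ℤ) → ∑[ w ∈ K ] ⟪ α ∣ β w ⟫ ≡ ⟪ α ∣ (λ y → ∑[ w ∈ K ] β w y) ⟫
  ⟪⟫-∑ʳ K α β = trans (∑-comm₃ K L L (λ w x y → α x * (β w y * k x y))) (∑-cong L λ x → ∑-cong L λ y →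
    trans (∑-*ˡ K (α x) (λ w → β w y * k x y)) (cong (α x *_) (∑-*ʳ K (k x y) (λ w → β w y))))

  ⟪⟫-∑∑ : ∀ (K : List Y) (K′ : List Z) (α : Y → X → ℤ) (β : Z → X → ℤ) →
    ∑[ v ∈ K ] ∑[ w ∈ K′ ] ⟪ α v ∣ β w ⟫ ≡ ⟪ (λ x → ∑[ v ∈ K ] α v x) ∣ (λ y → ∑[ w ∈ K′ ] β w y) ⟫
  ⟪⟫-∑∑ K K′ α β = trans (∑-cong K λ v → ⟪⟫-∑ʳ K′ (α v) β) (⟪⟫-∑ˡ K α (λ y → ∑[ w ∈ K′ ] β w y))

open module IntersectionPairing {n} = Pairing (allSubsets n) (λ x y → χ (meets x y))

fij-⟪⟫ : ∀ (A B : Graph n) i j → + fij A B i j ≡ ⟪ χ ∘ isSimplex A i ∣ χ ∘ isSimplex B j ⟫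
fij-⟪⟫ {n} A B i j = begin
  + fij A B i j
    ≡⟨ +-sum L (λ x → sum (map (counts x) L)) ⟩
  ∑[ x ∈ L ] + sum (map (counts x) L)
    ≡⟨ ∑-cong L (λ x → +-sum L (counts x)) ⟩
  ∑[ x ∈ L ] ∑[ y ∈ L ] χ (isSimplex A i x ∧ isSimplex B j y ∧ meets x y)
    ≡⟨ ∑-cong L (λ x → ∑-cong L λ y → trans (χ-∧ (isSimplex A i x) _)
         (cong (χ (isSimplex A i x) *_) (χ-∧ (isSimplex B j y) (meets x y)))) ⟩
  ⟪ χ ∘ isSimplex A i ∣ χ ∘ isSimplex B j ⟫ ∎
  where
  open ≡-Reasoning
  L = allSubsets n
  counts : Vec Bool n → Vec Bool n → ℕ
  counts x y = if isSimplex A i x ∧ isSimplex B j y ∧ meets x y then 1 else 0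

fij-bilinear : ∀ (A A′ B B′ : Graph n) i j →
  + fij A B i j - + fij A B′ i j - + fij A′ B i j + + fij A′ B′ i j ≡
  ⟪ (λ x → χ (isSimplex A i x) - χ (isSimplex A′ i x)) ∣ (λ y → χ (isSimplex B j y) - χ (isSimplex B′ j y)) ⟫
fij-bilinear {n} A A′ B B′ i j
  rewrite fij-⟪⟫ A B i j | fij-⟪⟫ A B′ i j | fij-⟪⟫ A′ B i j | fij-⟪⟫ A′ B′ i j
  = sym (⟪⟫-expand {n} (χ ∘ isSimplex A i) (χ ∘ isSimplex A′ i) (χ ∘ isSimplex B j) (χ ∘ isSimplex B′ j))

-- Top vertices of simplices

module _ {c ℓ₁ ℓ₂} (O : StrictTotalOrder c ℓ₁ ℓ₂) {n} (A : Graph n) (g : Fin n → StrictTotalOrder.Carrier O) where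
  open StrictTotalOrder O using (_≈_; _<_; _<?_; asym)
  open StrictTotalOrderProperties O using (decTotalOrder)
  open Extrema (DecTotalOrder.totalOrder decTotalOrder) using (argmax; argmax-all; f[xs]≤f[argmax])

  -- Sg O A g v is definitionally induced A (lower v), and Bg O A g v is induced A (insert v (lower v)).
  lower : Fin n → Fin n → Bool
  lower v u = E A v u ∧ ⌊ g u <? g v ⌋

  δ : ℕ → Fin n → Vec Bool n → ℤ
  δ i v x = χ (isSimplex (Bg O A g v) i x) - χ (isSimplex (Sg O A g v) i x)

  module _ (x : Vec Bool n) where

    isTop : Fin n → Bool
    isTop v = lookup x v ∧ x ⊆ᵇ insert v (lower v)

    below-top : ∀ {u v} → T (isTop v) → T (lookup x u) → u ≢ v → g u < g v
    below-top {u} {v} top xu u≢v with to T-∨ (to (T-⊆ᵇ x (insert v (lower v))) (proj₂ (to T-∧ top)) u xu)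
    ... | inj₁ lower-vu = toWitness (proj₂ (to (T-∧ {E A v u}) lower-vu))
    ... | inj₂ u≡v = ⊥-elim (u≢v (toWitness u≡v))

    top-unique : ∀ {v w} → T (isTop w) → T (isTop v) → v ≡ w
    top-unique {v} {w} top-w top-v with v ≟ w
    ... | yes v≡w = v≡w
    ... | no v≢w = ⊥-elim (asym (below-top top-w (proj₁ (to T-∧ top-v)) v≢w)
                               (below-top top-v (proj₁ (to T-∧ top-w)) (v≢w ∘ sym)))

    -- The g-largest vertex of x is its top, because x is a clique and g is injective on edges.
    top-exists : ∀ {i} → LocallyInjective O A g → IsSimplex A i x → ∃ λ v → T (V A v ∧ isTop v)
    top-exists inj s = v , from T-∧ (⊆V s v xv , from T-∧ (xv , from (T-⊆ᵇ x (insert v (lower v))) covered))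
      where
      members = filter (T? ∘ lookup x) (allFin n)
      nonempty = card-nonempty {x = x} (card≡ s)
      v = argmax g (proj₁ nonempty) members
      xv : T (lookup x v)
      xv = argmax-all g {P = T ∘ lookup x} (proj₂ nonempty) (all-filter (T? ∘ lookup x) (allFin n))
      covered : ∀ u → T (lookup x u) → T (insert v (lower v) u)
      covered u xu with u ≟ v
      ... | yes _ = from (T-∨ {lower v u}) (inj₂ _)
      ... | no u≢v = from T-∨ (inj₁ (from T-∧ (clique s v u xv xu (u≢v ∘ sym) , fromWitness (strict g≤))))
        where
        g≤ : g u < g v ⊎ g u ≈ g v
        g≤ = All.lookup (f[xs]≤f[argmax] (proj₁ nonempty) members) (∈-filter⁺ (T? ∘ lookup x) (∈-allFin u) xu)
        strict : g u < g v ⊎ g u ≈ g v → g u < g v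
        strict (inj₁ gu<gv) = gu<gv
        strict (inj₂ gu≈gv) = ⊥-elim (inj u v (to T-≡ (clique s u v xu xv u≢v)) gu≈gv)

    ∑-top : ∀ {i} → LocallyInjective O A g → IsSimplex A i x → ∑[ v ∈ allFin n ] χ (V A v ∧ isTop v) ≡ + 1
    ∑-top inj s with top-exists inj s
    ... | v , top-v = ∑-χ-unique (λ w → V A w ∧ isTop w) top-v λ w top-w →
      top-unique (proj₂ (to (T-∧ {V A v}) top-v)) (proj₂ (to (T-∧ {V A w}) top-w))

    δ-top : IsSimpleGraph A → ∀ i v →
      (if V A v then δ i v x else + 0) ≡ χ (isSimplex A i x) * χ (V A v ∧ isTop v)
    δ-top simple i v with V A v
    ... | false = sym (*-zeroʳ (χ (isSimplex A i x)))
    ... | true = begin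
        χ (isSimplex (Bg O A g v) i x) - χ (isSimplex (Sg O A g v) i x)
          ≡⟨ cong₂ (λ p q → χ p - χ q) (isSimplex-induced A (insert v (lower v)) i x)
                                       (isSimplex-induced A (lower v) i x) ⟩
        χ (sA ∧ x ⊆ᵇ insert v (lower v)) - χ (sA ∧ x ⊆ᵇ lower v)
          ≡⟨ cong₂ _-_ (χ-∧ sA _) (χ-∧ sA _) ⟩
        χ sA * χ (x ⊆ᵇ insert v (lower v)) - χ sA * χ (x ⊆ᵇ lower v)
          ≡⟨ factor (χ sA) _ _ ⟩
        χ sA * (χ (x ⊆ᵇ insert v (lower v)) - χ (x ⊆ᵇ lower v))
          ≡⟨ cong (χ sA *_) (χ-⊆ᵇ-insert x (lower v) v ¬lower-vv) ⟩
        χ sA * χ (isTop v) ∎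
      where
      open ≡-Reasoning
      sA = isSimplex A i x
      factor : ∀ p q r → p * q - p * r ≡ p * (q - r)
      factor = solve-∀
      ¬lower-vv : ¬ T (lower v v)
      ¬lower-vv t = subst T (IsSimpleGraph.E-irr simple v) (proj₁ (to T-∧ t))

  ∑-δ : IsSimpleGraph A → LocallyInjective O A g → ∀ i x →
    ∑[ v ∈ vertices A ] δ i v x ≡ χ (isSimplex A i x)
  ∑-δ simple inj i x = begin
    ∑[ v ∈ vertices A ] δ i v x
      ≡⟨ ∑-filter (V A) (allFin n) (λ v → δ i v x) ⟩
    ∑[ v ∈ allFin n ] (if V A v then δ i v x else + 0)
      ≡⟨ ∑-cong (allFin n) (δ-top x simple i) ⟩
    ∑[ v ∈ allFin n ] χ sA * χ (V A v ∧ isTop x v)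
      ≡⟨ ∑-*ˡ (allFin n) (χ sA) (λ v → χ (V A v ∧ isTop x v)) ⟩
    χ sA * (∑[ v ∈ allFin n ] χ (V A v ∧ isTop x v))
      ≡⟨ χ-*-absorb sA (∑-top x inj ∘ to (T-isSimplex A i x)) ⟩
    χ sA ∎
    where
    open ≡-Reasoning
    sA = isSimplex A i x

theorem2 : ∀ {c ℓ₁ ℓ₂} (O : StrictTotalOrder c ℓ₁ ℓ₂) (n : ℕ) (G H : Graph n)
    → IsSimpleGraph G → IsSimpleGraph H
    → (g : Fin n → StrictTotalOrder.Carrier O)
    → LocallyInjective O G g → LocallyInjective O H g
    → ∀ i j → + fij G H i j ≡ sumV G (λ v → sumV H (λ w →
    + fij (Bg O G g v) (Bg O H g w) i j - + fij (Bg O G g v) (Sg O H g w) i j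
    - + fij (Sg O G g v) (Bg O H g w) i j + + fij (Sg O G g v) (Sg O H g w) i j))
theorem2 O n G H simpleG simpleH g injG injH i j = begin
  + fij G H i j
    ≡⟨ fij-⟪⟫ G H i j ⟩
  ⟪ χ ∘ isSimplex G i ∣ χ ∘ isSimplex H j ⟫
    ≡⟨ ⟪⟫-cong (sym ∘ ∑-δ O G g simpleG injG i) (sym ∘ ∑-δ O H g simpleH injH j) ⟩
  ⟪ (λ x → ∑[ v ∈ vertices G ] δ O G g i v x) ∣ (λ y → ∑[ w ∈ vertices H ] δ O H g j w y) ⟫
    ≡⟨ sym (⟪⟫-∑∑ (vertices G) (vertices H) (δ O G g i) (δ O H g j)) ⟩
  ∑[ v ∈ vertices G ] ∑[ w ∈ vertices H ] ⟪ δ O G g i v ∣ δ O H g j w ⟫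
    ≡⟨ sym (∑-cong (vertices G) λ v → ∑-cong (vertices H) λ w →
         fij-bilinear (Bg O G g v) (Sg O G g v) (Bg O H g w) (Sg O H g w) i j) ⟩
  ∑[ v ∈ vertices G ] ∑[ w ∈ vertices H ] term v w
    ≡⟨ sym (trans (sumV-∑ G (λ v → sumV H (term v))) (∑-cong (vertices G) λ v → sumV-∑ H (term v))) ⟩
  sumV G (λ v → sumV H (term v)) ∎
  where
  open ≡-Reasoning
  term : Fin n → Fin n → ℤ
  term v w = + fij (Bg O G g v) (Bg O H g w) i j - + fij (Bg O G g v) (Sg O H g w) i j
    - + fij (Sg O G g v) (Bg O H g w) i j + + fij (Sg O G g v) (Sg O H g w) i j
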